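{- For any connected graphs $G$ and $H$ of order at least two, the following hold: (i) $\mathrm{mob}(G\,\square\, H) \ge \max\{\mathrm{mob}(G), \mathrm{mob}(H)\}$; (ii) $\mathrm{mob}(G\,\square\, H) \ge \max\{\mathrm{gp}_o(G), \mathrm{gp}_o(H)\}$.
   Context: All graphs are simple and undirected. A set $S\subseteq V(G)$ is a general position set if no three vertices of $S$ lie on a common shortest path of $G$; $\mathrm{gp}(G)$ is the maximum size of such a set. Robots are placed, one per vertex, on a general position set $S$. A move $u\to v$ of a robot from $u\in S$ along an edge $uv$ is legal if $v\notin S$ and $(S\setminus\{u\})\cup\{v\}$ is again a general position set. $S$ is a mobile general position set if there is a sequence of legal moves starting from $S$ such that every vertex of $G$ is visited at least once by some robot; $\mathrm{mob}(G)$ is the maximum size of a mobile general position set. For $X\subseteq V(G)$, vertices $u,v$ are $X$-positionable if every shortest $u,v$-path $P$ satisfies $V(P)\cap X\subseteq\{u,v\}$. $X$ is an outer general position set if every pair $u,v$ with $u\in X$ and $v\in V(G)$ is $X$-positionable; $\mathrm{gp}_o(G)$ is the maximum size of an outer general position set. $G\,\square\, H$ is the Cartesian product: vertex set $V(G)\times V(H)$, with $(g,h)\sim(g',h')$ iff ($gg'\in E(G)$ and $h=h'$) or ($g=g'$ and $hh'\in E(H)$). -}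

module Defs where

open import Data.Nat using (ℕ; zero; suc; _+_; _*_; _≤_)
open import Data.Fin using (Fin; _≟_; remQuot)
open import Data.Fin.Subset using (Subset; _∈_; _∉_; ⁅_⁆; _∪_; _-_; ∣_∣)
open import Data.Bool using (Bool; true; false; _∧_; _∨_)
open import Data.Product using (Σ; ∃; _×_; _,_)
open import Data.Sum using (_⊎_)
open import Data.Empty using (⊥)
open import Data.List using (List; []; _∷_)
open import Data.List.Relation.Unary.Any using (Any)
open import Relation.Nullary using (¬_; does)
open import Relation.Binary.PropositionalEquality using (_≡_; _≢_)

record Graph : Set where
  field
    order : ℕ
    adj   : Fin order → Fin order → Bool
open Graph public

record IsSimple (G : Graph) : Set where
  field
    adj-sym   : ∀ u v → adj G u v ≡ adj G v u
    adj-irrefl : ∀ v → adj G v v ≡ false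

Vertex : Graph → Set
Vertex G = Fin (order G)

data Walk (G : Graph) : Vertex G → Vertex G → Set where
  [] : ∀ {u} → Walk G u u
  _∷_ : ∀ {u w v} → adj G u w ≡ true → Walk G w v → Walk G u v

len : ∀ {G u v} → Walk G u v → ℕ
len [] = zero
len (_ ∷ p) = suc (len p)

data OnWalk {G : Graph} (x : Vertex G) : ∀ {u v} → Walk G u v → Set where
  start : ∀ {v} {p : Walk G x v} → OnWalk x p
  later : ∀ {u w v} {e : adj G u w ≡ true} {p : Walk G w v} →
          OnWalk x p → OnWalk x (e ∷ p)

-- p is a shortest u,v-path (a u,v-walk of minimum length; such walks are paths)
IsShortest : ∀ {G u v} → Walk G u v → Set
IsShortest {G} {u} {v} p = ∀ (q : Walk G u v) → len p ≤ len q

Connected : Graph → Set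
Connected G = ∀ (u v : Vertex G) → Walk G u v

IsGeneralPosition : (G : Graph) → Subset (order G) → Set
IsGeneralPosition G S =
  ∀ {u v} (p : Walk G u v) → IsShortest p →
  ∀ (a b c : Vertex G) → a ≢ b → a ≢ c → b ≢ c →
  a ∈ S → b ∈ S → c ∈ S → OnWalk a p → OnWalk b p → OnWalk c p → ⊥

LegalMove : (G : Graph) → Subset (order G) → Subset (order G) → Set
LegalMove G S T =
  Σ (Vertex G) λ u → Σ (Vertex G) λ v →
    u ∈ S × adj G u v ≡ true × v ∉ S ×
    T ≡ (S - u) ∪ ⁅ v ⁆ × IsGeneralPosition G T

data Moves (G : Graph) : Subset (order G) → List (Subset (order G)) → Set where
  done : ∀ {S} → Moves G S []
  step : ∀ {S T Ts} → LegalMove G S T → Moves G T Ts → Moves G S (T ∷ Ts)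

IsMobileGP : (G : Graph) → Subset (order G) → Set
IsMobileGP G S =
  IsGeneralPosition G S ×
  Σ (List (Subset (order G))) λ Ts →
    Moves G S Ts × (∀ (x : Vertex G) → Any (x ∈_) (S ∷ Ts))

IsOuterGP : (G : Graph) → Subset (order G) → Set
IsOuterGP G X =
  ∀ (u : Vertex G) → u ∈ X → ∀ (v : Vertex G) (p : Walk G u v) → IsShortest p →
  ∀ (w : Vertex G) → OnWalk w p → w ∈ X → (w ≡ u ⊎ w ≡ v)

IsMaxSize : ∀ {n} → (Subset n → Set) → ℕ → Set
IsMaxSize {n} P k = (Σ (Subset n) λ S → P S × ∣ S ∣ ≡ k) × (∀ S → P S → ∣ S ∣ ≤ k)

IsMob : Graph → ℕ → Set
IsMob G k = IsMaxSize (IsMobileGP G) k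

IsGpo : Graph → ℕ → Set
IsGpo G k = IsMaxSize (IsOuterGP G) k

-- Cartesian product G □ H; vertex (g , h) is encoded as combine g h : Fin (|G| * |H|).
_□_ : Graph → Graph → Graph
G □ H = record
  { order = order G * order H
  ; adj = λ x y → go (remQuot {order G} (order H) x) (remQuot {order G} (order H) y)
  }
  where
  go : Vertex G × Vertex H → Vertex G × Vertex H → Bool
  go (g , h) (g' , h') = (adj G g g' ∧ does (h ≟ h')) ∨ (does (g ≟ g') ∧ adj H h h')

module Submission where

-- Robots on K = A □ B are in general position whenever their A-coordinates are pairwise
-- distinct and form a general position set of A, since the A-projection of a geodesic of K
-- is a geodesic of A. So a layer S × {h} can be moved robot by robot to any other layer, and
-- the legal moves of A can be replayed inside a layer: if S is mobile in A, then S × {h} is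
-- mobile in K. For an outer general position set X, the robots of X × {c} reach (g, k) by
-- moving to a layer L ≠ k, after which a single robot e ∈ X walks along its column to row k
-- and along a geodesic of that row to g; outerness keeps that geodesic out of the other
-- robots' columns. Legal moves can be undone, so reaching every vertex from the start
-- suffices for mobility; |S × {h}| = |S|, and transposing the product gives the bounds for H.

open import Defs
open import Data.Bool using (Bool; true; false; _∧_; _∨_) renaming (_≟_ to _≟ᵇ_)
open import Data.Bool.Properties using (∨-zeroʳ; ∧-zeroʳ)
open import Data.Empty using (⊥)
open import Data.Fin using (Fin; _≟_; zero; suc; combine; remQuot; fromℕ<)
open import Data.Fin.Properties as Finₚ using (any?; 0≢1+n; remQuot-combine; combine-remQuot)
open import Data.Fin.Subset using (Subset; Nonempty; _∈_; _∉_; _⊆_; ⁅_⁆; _∪_; _─_; _-_; ∣_∣; inside; outside)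
open import Data.Fin.Subset.Properties
  using (x∈p∪q⁻; x∈p∪q⁺; x∈⁅x⁆; x∈⁅y⁆⇒x≡y; x∈p∧x≢y⇒x∈p-y; x∈p⇒∣p-x∣<∣p∣; p─q⊆p; ⊆-antisym; _∈?_;
         nonempty?; Empty-unique; ∣⊥∣≡0)
open import Data.List using (List; []; _∷_; allFin)
open import Data.List.Membership.Propositional using () renaming (_∈_ to _∈ₗ_)
open import Data.List.Membership.Propositional.Properties using (∈-allFin)
open import Data.List.Relation.Unary.Any using (Any; here; there)
open import Data.Nat using (ℕ; zero; suc; _+_; _≤_; _<_; _⊔_; z≤n; s≤s)
open import Data.Nat.Induction using (<-rec)
open import Data.Nat.Properties
  using (module ≤-Reasoning; ≤-trans; +-cancelʳ-≤; +-cancelˡ-≤; +-suc; +-comm; ≮⇒≥; anyUpTo?; ⊔-lub)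
open import Data.Product as Prod using (Σ; ∃; _×_; _,_; proj₁; proj₂)
open import Data.Sum as Sum using (_⊎_; inj₁; inj₂)
open import Data.Vec using ([]; _∷_; here; there; tabulate)
open import Data.Vec.Functional using (updateAt)
open import Data.Vec.Functional.Properties using (updateAt-updates; updateAt-minimal)
open import Data.Vec.Properties using (lookup∘tabulate; []=⇒lookup; lookup⇒[]=)
open import Function using (_∘_; const)
open import Function.Definitions using (Injective)
open import Relation.Binary.PropositionalEquality
  using (_≡_; _≢_; refl; sym; trans; cong; cong₂; subst; subst₂; ≢-sym; module ≡-Reasoning)
open import Relation.Nullary using (¬_; Dec; yes; no; does; contradiction)
open import Relation.Nullary.Decidable using (_×-dec_; dec-true)
open import Relation.Unary using (Decidable)

x∈p─q⇒x∉q : ∀ {n} {x : Fin n} {p q : Subset n} → x ∈ p ─ q → x ∉ q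
x∈p─q⇒x∉q {p = _ ∷ _} {inside ∷ _} () here
x∈p─q⇒x∉q {p = _ ∷ _} {outside ∷ _} here ()
x∈p─q⇒x∉q {p = _ ∷ _} {_ ∷ _} (there x∈p─q) (there x∈q) = x∈p─q⇒x∉q x∈p─q x∈q

x∈p-y⇒x≢y : ∀ {n} {x y : Fin n} {p : Subset n} → x ∈ p - y → x ≢ y
x∈p-y⇒x≢y {y = y} x∈p-y refl = x∈p─q⇒x∉q x∈p-y (x∈⁅x⁆ y)

x∉p-x : ∀ {n} {x : Fin n} {p : Subset n} → x ∉ p - x
x∉p-x x∈p-x = x∈p-y⇒x≢y x∈p-x refl

x∈p-y⇒x∈p : ∀ {n} {x y : Fin n} {p : Subset n} → x ∈ p - y → x ∈ p
x∈p-y⇒x∈p {y = y} {p} = p─q⊆p p ⁅ y ⁆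

x∈p∪⁅y⁆⁻ : ∀ {n} {x y : Fin n} (p : Subset n) → x ∈ p ∪ ⁅ y ⁆ → x ∈ p ⊎ x ≡ y
x∈p∪⁅y⁆⁻ {y = y} p x∈ with x∈p∪q⁻ p ⁅ y ⁆ x∈
... | inj₁ x∈p = inj₁ x∈p
... | inj₂ x∈⁅y⁆ = inj₂ (x∈⁅y⁆⇒x≡y y x∈⁅y⁆)

x∈p∪⁅y⁆⁺ : ∀ {n} {x y : Fin n} {p : Subset n} → x ∈ p ⊎ x ≡ y → x ∈ p ∪ ⁅ y ⁆
x∈p∪⁅y⁆⁺ (inj₁ x∈p) = x∈p∪q⁺ (inj₁ x∈p)
x∈p∪⁅y⁆⁺ (inj₂ refl) = x∈p∪q⁺ (inj₂ (x∈⁅x⁆ _))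

p-x∪⁅x⁆≡p : ∀ {n} {x : Fin n} {p : Subset n} → x ∈ p → (p - x) ∪ ⁅ x ⁆ ≡ p
p-x∪⁅x⁆≡p {x = x} {p} x∈p = ⊆-antisym ⊆p p⊆
  where
  ⊆p : (p - x) ∪ ⁅ x ⁆ ⊆ p
  ⊆p y∈ with x∈p∪⁅y⁆⁻ (p - x) y∈
  ... | inj₁ y∈p-x = x∈p-y⇒x∈p y∈p-x
  ... | inj₂ refl = x∈p
  p⊆ : p ⊆ (p - x) ∪ ⁅ x ⁆
  p⊆ {y} y∈p with y ≟ x
  ... | yes y≡x = x∈p∪⁅y⁆⁺ (inj₂ y≡x)
  ... | no y≢x = x∈p∪⁅y⁆⁺ (inj₁ (x∈p∧x≢y⇒x∈p-y y∈p y≢x))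

[p∪⁅x⁆]-x≡p : ∀ {n} {x : Fin n} {p : Subset n} → x ∉ p → (p ∪ ⁅ x ⁆) - x ≡ p
[p∪⁅x⁆]-x≡p {x = x} {p} x∉p = ⊆-antisym ⊆p p⊆
  where
  ⊆p : (p ∪ ⁅ x ⁆) - x ⊆ p
  ⊆p y∈ with x∈p∪⁅y⁆⁻ p (x∈p-y⇒x∈p y∈)
  ... | inj₁ y∈p = y∈p
  ... | inj₂ y≡x = contradiction y≡x (x∈p-y⇒x≢y y∈)
  p⊆ : p ⊆ (p ∪ ⁅ x ⁆) - x
  p⊆ y∈p = x∈p∧x≢y⇒x∈p-y (x∈p∪⁅y⁆⁺ (inj₁ y∈p)) (λ { refl → x∉p y∈p })

∣p∣≤∣q∣-injection : ∀ {m n} {p : Subset m} {q : Subset n} (f : Fin m → Fin n) → Injective _≡_ _≡_ f →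
                    (∀ {i} → i ∈ p → f i ∈ q) → ∣ p ∣ ≤ ∣ q ∣
∣p∣≤∣q∣-injection {p = []} f f-inj f[p]⊆q = z≤n
∣p∣≤∣q∣-injection {p = outside ∷ p} f f-inj f[p]⊆q =
  ∣p∣≤∣q∣-injection (f ∘ suc) (Finₚ.suc-injective ∘ f-inj) (f[p]⊆q ∘ there)
∣p∣≤∣q∣-injection {p = inside ∷ p} {q} f f-inj f[p]⊆q =
  ≤-trans (s≤s (∣p∣≤∣q∣-injection {q = q - f zero} (f ∘ suc) (Finₚ.suc-injective ∘ f-inj)
                  (λ i∈p → x∈p∧x≢y⇒x∈p-y (f[p]⊆q (there i∈p)) (λ eq → 0≢1+n (sym (f-inj eq))))))
          (x∈p⇒∣p-x∣<∣p∣ (f[p]⊆q here))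

∃-≢ : ∀ {n} → 2 ≤ n → (k : Fin n) → ∃ (k ≢_)
∃-≢ {suc (suc _)} _ zero = suc zero , λ ()
∃-≢ {suc (suc _)} _ (suc _) = zero , λ ()
∃-≢ {suc zero} (s≤s ()) _

choose-preferring : ∀ {n} {X : Subset n} → Nonempty X → ∀ y → ∃ λ x → x ∈ X × (y ∈ X → x ≡ y)
choose-preferring {X = X} (x , x∈X) y with y ∈? X
... | yes y∈X = y , y∈X , λ _ → refl
... | no y∉X = x , x∈X , λ y∈X → contradiction y∈X y∉X

module _ {n} {P : Fin n → Set} (P? : Decidable P) where

  fromDecidable : Subset n
  fromDecidable = tabulate (does ∘ P?)

  ∈-fromDecidable⁻ : ∀ {x} → x ∈ fromDecidable → P x
  ∈-fromDecidable⁻ {x} x∈ with P? x | trans (sym (lookup∘tabulate (does ∘ P?) x)) ([]=⇒lookup x∈)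
  ... | yes Px | _ = Px
  ... | no _ | ()

  ∈-fromDecidable⁺ : ∀ {x} → P x → x ∈ fromDecidable
  ∈-fromDecidable⁺ {x} Px = lookup⇒[]= x _ (trans (lookup∘tabulate (does ∘ P?) x) (dec-true (P? x) Px))

module _ {K : Graph} where

  castWalk : ∀ {u u' v v'} → u ≡ u' → v ≡ v' → Walk K u' v' → Walk K u v
  castWalk refl refl p = p

  len-castWalk : ∀ {u u' v v'} (u≡ : u ≡ u') (v≡ : v ≡ v') (p : Walk K u' v') → len (castWalk u≡ v≡ p) ≡ len p
  len-castWalk refl refl p = refl

  onWalk-castWalk : ∀ {x u u' v v'} (u≡ : u ≡ u') (v≡ : v ≡ v') {p : Walk K u' v'} → OnWalk x p → OnWalk x (castWalk u≡ v≡ p)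
  onWalk-castWalk refl refl x∈p = x∈p

  infixr 5 _++_

  _++_ : ∀ {u v w} → Walk K u v → Walk K v w → Walk K u w
  [] ++ q = q
  (e ∷ p) ++ q = e ∷ (p ++ q)

  len-++ : ∀ {u v w} (p : Walk K u v) (q : Walk K v w) → len (p ++ q) ≡ len p + len q
  len-++ [] q = refl
  len-++ (e ∷ p) q = cong suc (len-++ p q)

  onWalk-end : ∀ {u v} (p : Walk K u v) → OnWalk v p
  onWalk-end [] = start
  onWalk-end (e ∷ p) = later (onWalk-end p)

  onWalk-++ˡ : ∀ {x u v w} {p : Walk K u v} (q : Walk K v w) → OnWalk x p → OnWalk x (p ++ q)
  onWalk-++ˡ q start = start
  onWalk-++ˡ q (later x∈p) = later (onWalk-++ˡ q x∈p)

  onWalk-++ʳ : ∀ {x u v w} (p : Walk K u v) {q : Walk K v w} → OnWalk x q → OnWalk x (p ++ q)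
  onWalk-++ʳ [] x∈q = x∈q
  onWalk-++ʳ (e ∷ p) x∈q = later (onWalk-++ʳ p x∈q)

  onWalk-++⁻ : ∀ {x u v w} (p : Walk K u v) (q : Walk K v w) → OnWalk x (p ++ q) → OnWalk x p ⊎ OnWalk x q
  onWalk-++⁻ [] q x∈q = inj₂ x∈q
  onWalk-++⁻ (e ∷ p) q start = inj₁ start
  onWalk-++⁻ (e ∷ p) q (later x∈) with onWalk-++⁻ p q x∈
  ... | inj₁ x∈p = inj₁ (later x∈p)
  ... | inj₂ x∈q = inj₂ x∈q

  record Split {u v} (p : Walk K u v) (x : Vertex K) : Set where
    field
      before : Walk K u x
      after : Walk K x v
      ≡before++after : before ++ after ≡ p

  split : ∀ {x u v} (p : Walk K u v) → OnWalk x p → Split p x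
  split p start = record { before = [] ; after = p ; ≡before++after = refl }
  split (e ∷ p) (later x∈p) = record { before = e ∷ before ; after = after ; ≡before++after = cong (e ∷_) ≡before++after }
    where open Split (split p x∈p)

  ++-assoc : ∀ {u v w x} (p : Walk K u v) (q : Walk K v w) (r : Walk K w x) → (p ++ q) ++ r ≡ p ++ (q ++ r)
  ++-assoc [] q r = refl
  ++-assoc (e ∷ p) q r = cong (e ∷_) (++-assoc p q r)

  shortest-++ˡ : ∀ {u v w} (p : Walk K u v) (q : Walk K v w) → IsShortest (p ++ q) → IsShortest p
  shortest-++ˡ p q p++q-shortest p' = +-cancelʳ-≤ (len q) (len p) (len p') (begin
    len p + len q    ≡⟨ len-++ p q ⟨
    len (p ++ q)     ≤⟨ p++q-shortest (p' ++ q) ⟩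
    len (p' ++ q)    ≡⟨ len-++ p' q ⟩
    len p' + len q   ∎)
    where open ≤-Reasoning

  shortest-++ʳ : ∀ {u v w} (p : Walk K u v) (q : Walk K v w) → IsShortest (p ++ q) → IsShortest q
  shortest-++ʳ p q p++q-shortest q' = +-cancelˡ-≤ (len p) (len q) (len q') (begin
    len p + len q    ≡⟨ len-++ p q ⟨
    len (p ++ q)     ≤⟨ p++q-shortest (p ++ q') ⟩
    len (p ++ q')    ≡⟨ len-++ p q' ⟩
    len p + len q'   ∎)
    where open ≤-Reasoning

  onWalk-shortestLoop : ∀ {x u v} (p : Walk K u v) → IsShortest p → u ≡ v → OnWalk x p → x ≡ u
  onWalk-shortestLoop [] p-shortest refl start = refl
  onWalk-shortestLoop (e ∷ p) p-shortest refl x∈p with p-shortest []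
  ... | ()

  shortest-ordered : ∀ {u v b c} (p : Walk K u v) → IsShortest p → OnWalk b p → OnWalk c p →
                     (Σ (Walk K u c) λ q → IsShortest q × OnWalk b q) ⊎
                     (Σ (Walk K u b) λ q → IsShortest q × OnWalk c q)
  shortest-ordered p p-shortest b∈p c∈p with split p c∈p
  ... | record { before = p₁ ; after = p₂ ; ≡before++after = refl } with onWalk-++⁻ p₁ p₂ b∈p
  ... | inj₁ b∈p₁ = inj₁ (p₁ , shortest-++ˡ p₁ p₂ p-shortest , b∈p₁)
  ... | inj₂ b∈p₂ with split p₂ b∈p₂
  ... | record { before = s₁ ; after = s₂ ; ≡before++after = refl } =
    inj₂ (p₁ ++ s₁ , shortest-++ˡ (p₁ ++ s₁) s₂ (subst IsShortest (sym (++-assoc p₁ s₁ s₂)) p-shortest) ,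
          onWalk-++ˡ s₁ (onWalk-end p₁))

  NoneBetween : Subset (order K) → Set
  NoneBetween S = ∀ {u v} (p : Walk K u v) → IsShortest p → u ≢ v →
                  ∀ {m} → OnWalk m p → m ≢ u → m ≢ v → u ∈ S → m ∈ S → v ∈ S → ⊥

  noneBetween⇒generalPosition : ∀ {S} → NoneBetween S → IsGeneralPosition K S
  noneBetween⇒generalPosition {S} none = gp
    where
    fromStart : ∀ {u v x y} (p : Walk K u v) → IsShortest p → u ≢ x → u ≢ y → x ≢ y →
                u ∈ S → x ∈ S → y ∈ S → OnWalk x p → OnWalk y p → ⊥
    fromStart p p-shortest u≢x u≢y x≢y u∈S x∈S y∈S x∈p y∈p with shortest-ordered p p-shortest x∈p y∈p
    ... | inj₁ (q , q-shortest , x∈q) = none q q-shortest u≢y x∈q (≢-sym u≢x) x≢y u∈S x∈S y∈S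
    ... | inj₂ (q , q-shortest , y∈q) = none q q-shortest u≢x y∈q (≢-sym u≢y) (≢-sym x≢y) u∈S y∈S x∈S

    gp : IsGeneralPosition K S
    gp p p-shortest a b c a≢b a≢c b≢c a∈S b∈S c∈S start b∈p c∈p =
      fromStart p p-shortest a≢b a≢c b≢c a∈S b∈S c∈S b∈p c∈p
    gp p p-shortest a b c a≢b a≢c b≢c a∈S b∈S c∈S a∈p start c∈p =
      fromStart p p-shortest (≢-sym a≢b) b≢c a≢c b∈S a∈S c∈S a∈p c∈p
    gp p p-shortest a b c a≢b a≢c b≢c a∈S b∈S c∈S a∈p b∈p start =
      fromStart p p-shortest (≢-sym a≢c) (≢-sym b≢c) a≢b c∈S a∈S b∈S a∈p b∈p
    gp (e ∷ p) p-shortest a b c a≢b a≢c b≢c a∈S b∈S c∈S (later a∈p) (later b∈p) (later c∈p) =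
      gp p (shortest-++ʳ (e ∷ []) p p-shortest) a b c a≢b a≢c b≢c a∈S b∈S c∈S a∈p b∈p c∈p

  WalkOfLength : ℕ → Vertex K → Vertex K → Set
  WalkOfLength n u v = Σ (Walk K u v) λ p → len p ≡ n

  walkOfLength? : ∀ n u v → Dec (WalkOfLength n u v)
  walkOfLength? zero u v with u ≟ v
  ... | yes refl = yes ([] , refl)
  ... | no u≢v = no λ { ([] , _) → u≢v refl }
  walkOfLength? (suc n) u v with any? (λ w → (adj K u w ≟ᵇ true) ×-dec walkOfLength? n w v)
  ... | yes (w , e , p , refl) = yes (e ∷ p , refl)
  ... | no ∄ = no λ { (e ∷ p , refl) → ∄ (_ , e , p , refl) }

  shortestWalk : ∀ {u v} → Walk K u v → Σ (Walk K u v) IsShortest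
  shortestWalk {u} {v} p = <-rec (λ n → WalkOfLength n u v → Σ (Walk K u v) IsShortest) shorten (len p) (p , refl)
    where
    shorten : ∀ n → (∀ {m} → m < n → WalkOfLength m u v → Σ (Walk K u v) IsShortest) →
              WalkOfLength n u v → Σ (Walk K u v) IsShortest
    shorten n rec (p , refl) with anyUpTo? (λ m → walkOfLength? m u v) (len p)
    ... | yes (m , m<n , q) = rec m<n q
    ... | no ∄ = p , λ q → ≮⇒≥ λ q<p → ∄ (len q , q<p , q , refl)

outer⇒generalPosition : ∀ {G X} → IsOuterGP G X → IsGeneralPosition G X
outer⇒generalPosition X-outer = noneBetween⇒generalPosition λ p p-shortest _ m∈p m≢u m≢v u∈X m∈X _ →
  Sum.[ m≢u , m≢v ] (X-outer _ u∈X _ p p-shortest _ m∈p m∈X)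

module _ {K : Graph} (K-simple : IsSimple K) where
  open IsSimple K-simple

  adj⇒≢ : ∀ {u v} → adj K u v ≡ true → u ≢ v
  adj⇒≢ {u} e refl with trans (sym e) (adj-irrefl u)
  ... | ()

  reverse : ∀ {u v} → Walk K u v → Walk K v u
  reverse [] = []
  reverse (_∷_ {u} {w} e p) = reverse p ++ (trans (adj-sym w u) e ∷ [])

  len-reverse : ∀ {u v} (p : Walk K u v) → len (reverse p) ≡ len p
  len-reverse [] = refl
  len-reverse (e ∷ p) = trans (len-++ (reverse p) _) (trans (+-comm (len (reverse p)) 1) (cong suc (len-reverse p)))

  onWalk-reverse : ∀ {x u v} (p : Walk K u v) → OnWalk x p → OnWalk x (reverse p)
  onWalk-reverse [] start = start
  onWalk-reverse (e ∷ p) start = onWalk-++ʳ (reverse p) (later start)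
  onWalk-reverse (e ∷ p) (later x∈p) = onWalk-++ˡ _ (onWalk-reverse p x∈p)

  shortest-reverse : ∀ {u v} (p : Walk K u v) → IsShortest p → IsShortest (reverse p)
  shortest-reverse p p-shortest q = begin
    len (reverse p)  ≡⟨ len-reverse p ⟩
    len p            ≤⟨ p-shortest (reverse q) ⟩
    len (reverse q)  ≡⟨ len-reverse q ⟩
    len q            ∎
    where open ≤-Reasoning

data Run (K : Graph) : Subset (order K) → Subset (order K) → Set where
  ε : ∀ {C} → Run K C C
  _◅_ : ∀ {C T D} → LegalMove K C T → Run K T D → Run K C D

infixr 5 _◅_

module _ {K : Graph} where

  infixr 5 _◅◅_

  _◅◅_ : ∀ {C D E} → Run K C D → Run K D E → Run K C E
  ε ◅◅ s = s
  (m ◅ r) ◅◅ s = m ◅ (r ◅◅ s)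

  configurations : ∀ {C D} → Run K C D → List (Subset (order K))
  configurations ε = []
  configurations (_◅_ {T = T} m r) = T ∷ configurations r

  run⇒moves : ∀ {C D} (r : Run K C D) → Moves K C (configurations r)
  run⇒moves ε = done
  run⇒moves (m ◅ r) = step m (run⇒moves r)

  Visits : ∀ {C D} → Run K C D → Vertex K → Set
  Visits {C} r z = Any (z ∈_) (C ∷ configurations r)

  visits-end : ∀ {C D z} (r : Run K C D) → z ∈ D → Visits r z
  visits-end ε z∈D = here z∈D
  visits-end (m ◅ r) z∈D = there (visits-end r z∈D)

  visits-◅◅ˡ : ∀ {C D E z} (r : Run K C D) (s : Run K D E) → Visits r z → Visits (r ◅◅ s) z
  visits-◅◅ˡ ε s (here z∈C) = here z∈C
  visits-◅◅ˡ (m ◅ r) s (here z∈C) = here z∈C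
  visits-◅◅ˡ (m ◅ r) s (there z∈) = there (visits-◅◅ˡ r s z∈)

  visits-◅◅ʳ : ∀ {C D E z} (r : Run K C D) (s : Run K D E) → Visits s z → Visits (r ◅◅ s) z
  visits-◅◅ʳ ε s z∈ = z∈
  visits-◅◅ʳ (m ◅ r) s z∈ = there (visits-◅◅ʳ r s z∈)

CanOccupy : (K : Graph) → Subset (order K) → Vertex K → Set
CanOccupy K C z = Σ (Subset (order K)) λ D → Run K C D × z ∈ D

CanJoin : (K : Graph) → Subset (order K) → Vertex K → Set
CanJoin K C v = v ∉ C × IsGeneralPosition K (C ∪ ⁅ v ⁆)

module _ {K : Graph} (K-simple : IsSimple K) where
  open IsSimple K-simple

  soloMove : ∀ {C p q} → adj K p q ≡ true → p ∉ C → CanJoin K C q → LegalMove K (C ∪ ⁅ p ⁆) (C ∪ ⁅ q ⁆)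
  soloMove {C} {p} {q} e p∉C (q∉C , gp) =
    p , q , x∈p∪⁅y⁆⁺ (inj₂ refl) , e , q∉C∪⁅p⁆ , cong (_∪ ⁅ q ⁆) (sym ([p∪⁅x⁆]-x≡p p∉C)) , gp
    where
    q∉C∪⁅p⁆ : q ∉ C ∪ ⁅ p ⁆
    q∉C∪⁅p⁆ q∈ with x∈p∪⁅y⁆⁻ C q∈
    ... | inj₁ q∈C = q∉C q∈C
    ... | inj₂ refl = adj⇒≢ K-simple e refl

  walkAlone : ∀ C {p p'} (w : Walk K p p') → (∀ {v} → OnWalk v w → CanJoin K C v) → Run K (C ∪ ⁅ p ⁆) (C ∪ ⁅ p' ⁆)
  walkAlone C [] canJoin = ε
  walkAlone C (e ∷ w) canJoin = soloMove e (proj₁ (canJoin start)) (canJoin (later start)) ◅ walkAlone C w (canJoin ∘ later)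

  reverseMove : ∀ {C T} → IsGeneralPosition K C → LegalMove K C T → LegalMove K T C
  reverseMove {C} C-gp (u , v , u∈C , e , v∉C , refl , _) =
    subst (LegalMove K _) (p-x∪⁅x⁆≡p u∈C)
          (soloMove (trans (adj-sym v u) e) (v∉C ∘ x∈p-y⇒x∈p)
                    (x∉p-x , subst (IsGeneralPosition K) (sym (p-x∪⁅x⁆≡p u∈C)) C-gp))

  reverseRun : ∀ {C D} → IsGeneralPosition K C → (r : Run K C D) → Σ (Run K D C) λ r' → ∀ {z} → Visits r z → Visits r' z
  reverseRun C-gp ε = ε , λ z∈ → z∈
  reverseRun C-gp (m@(_ , _ , _ , _ , _ , _ , T-gp) ◅ r) with reverseRun T-gp r
  ... | r' , r⊆r' = r' ◅◅ (reverseMove C-gp m ◅ ε) , visits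
    where
    visits : ∀ {z} → Visits (m ◅ r) z → Visits (r' ◅◅ (reverseMove C-gp m ◅ ε)) z
    visits (here z∈C) = visits-◅◅ʳ r' _ (there (here z∈C))
    visits (there z∈) = visits-◅◅ˡ r' _ (r⊆r' z∈)

  roundTrip : ∀ {C} → IsGeneralPosition K C → (∀ z → CanOccupy K C z) →
              (zs : List (Vertex K)) → Σ (Run K C C) λ r → ∀ {z} → z ∈ₗ zs → Visits r z
  roundTrip C-gp occupy [] = ε , λ ()
  roundTrip C-gp occupy (z ∷ zs) with occupy z | roundTrip C-gp occupy zs
  ... | D , out , z∈D | r , zs⊆r = (out ◅◅ back) ◅◅ r , visits
    where
    back = proj₁ (reverseRun C-gp out)
    visits : ∀ {y} → y ∈ₗ z ∷ zs → Visits ((out ◅◅ back) ◅◅ r) y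
    visits (here refl) = visits-◅◅ˡ (out ◅◅ back) r (visits-◅◅ˡ out back (visits-end out z∈D))
    visits (there y∈zs) = visits-◅◅ʳ (out ◅◅ back) r (zs⊆r y∈zs)

  occupyAll⇒mobile : ∀ {C} → IsGeneralPosition K C → (∀ z → CanOccupy K C z) → IsMobileGP K C
  occupyAll⇒mobile C-gp occupy with roundTrip C-gp occupy (allFin (order K))
  ... | r , visits = C-gp , configurations r , run⇒moves r , λ z → visits (∈-allFin z)

record IsCartesianProduct (A B K : Graph) : Set where
  field
    pair : Vertex A → Vertex B → Vertex K
    fst : Vertex K → Vertex A
    snd : Vertex K → Vertex B
    fst-pair : ∀ a b → fst (pair a b) ≡ a
    snd-pair : ∀ a b → snd (pair a b) ≡ b
    pair-fst-snd : ∀ z → pair (fst z) (snd z) ≡ z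
    adj⇒ : ∀ {z w} → adj K z w ≡ true →
           (adj A (fst z) (fst w) ≡ true × snd z ≡ snd w) ⊎ (fst z ≡ fst w × adj B (snd z) (snd w) ≡ true)
    adjˡ : ∀ {a a'} b → adj A a a' ≡ true → adj K (pair a b) (pair a' b) ≡ true
    adjʳ : ∀ a {b b'} → adj B b b' ≡ true → adj K (pair a b) (pair a b') ≡ true

transpose : ∀ {A B K} → IsCartesianProduct A B K → IsCartesianProduct B A K
transpose P = record
  { pair = λ b a → pair a b
  ; fst = snd
  ; snd = fst
  ; fst-pair = λ b a → snd-pair a b
  ; snd-pair = λ b a → fst-pair a b
  ; pair-fst-snd = pair-fst-snd
  ; adj⇒ = Sum.swap ∘ Sum.map Prod.swap Prod.swap ∘ adj⇒
  ; adjˡ = λ a e → adjʳ a e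
  ; adjʳ = λ b e → adjˡ b e
  }
  where open IsCartesianProduct P

module _ (G H : Graph) where
  private
    fst : Vertex (G □ H) → Vertex G
    fst z = proj₁ (remQuot {order G} (order H) z)
    snd : Vertex (G □ H) → Vertex H
    snd z = proj₂ (remQuot {order G} (order H) z)

    -- adj (G □ H) z w is definitionally adjacent (remQuot z) (remQuot w).
    adjacent : Vertex G × Vertex H → Vertex G × Vertex H → Bool
    adjacent (g , h) (g' , h') = (adj G g g' ∧ does (h ≟ h')) ∨ (does (g ≟ g') ∧ adj H h h')

    adj-combine : ∀ a b a' b' → adj (G □ H) (combine a b) (combine a' b') ≡ adjacent (a , b) (a' , b')
    adj-combine a b a' b' = cong₂ adjacent (remQuot-combine a b) (remQuot-combine a' b')

  □-isCartesianProduct : IsCartesianProduct G H (G □ H)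
  □-isCartesianProduct = record
    { pair = combine
    ; fst = fst
    ; snd = snd
    ; fst-pair = λ a b → cong proj₁ (remQuot-combine a b)
    ; snd-pair = λ a b → cong proj₂ (remQuot-combine a b)
    ; pair-fst-snd = combine-remQuot {order G} (order H)
    ; adj⇒ = adj⇒
    ; adjˡ = adjˡ
    ; adjʳ = adjʳ
    }
    where
    adj⇒ : ∀ {z w} → adj (G □ H) z w ≡ true →
           (adj G (fst z) (fst w) ≡ true × snd z ≡ snd w) ⊎ (fst z ≡ fst w × adj H (snd z) (snd w) ≡ true)
    adj⇒ {z} {w} e with adj G (fst z) (fst w) | snd z ≟ snd w | fst z ≟ fst w | adj H (snd z) (snd w)
    ... | true  | yes eq | _      | _     = inj₁ (refl , eq)
    ... | _     | _      | yes eq | true  = inj₂ (eq , refl)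
    ... | false | _      | no _   | _     = contradiction e λ ()
    ... | false | _      | yes _  | false = contradiction e λ ()
    ... | true  | no _   | no _   | _     = contradiction e λ ()
    ... | true  | no _   | yes _  | false = contradiction e λ ()

    adjˡ : ∀ {a a'} b → adj G a a' ≡ true → adj (G □ H) (combine a b) (combine a' b) ≡ true
    adjˡ {a} {a'} b e rewrite adj-combine a b a' b | e | dec-true (b ≟ b) refl = refl

    adjʳ : ∀ a {b b'} → adj H b b' ≡ true → adj (G □ H) (combine a b) (combine a b') ≡ true
    adjʳ a {b} {b'} e rewrite adj-combine a b a b' | e | dec-true (a ≟ a) refl = ∨-zeroʳ _

  □-isSimple : IsSimple G → IsSimple H → IsSimple (G □ H)
  □-isSimple G-simple H-simple = record
    { adj-sym = λ z w → adjacent-sym (remQuot {order G} (order H) z) (remQuot (order H) w)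
    ; adj-irrefl = λ z → adjacent-irrefl (remQuot {order G} (order H) z)
    }
    where
    open IsSimple

    does-≟-sym : ∀ {n} (x y : Fin n) → does (x ≟ y) ≡ does (y ≟ x)
    does-≟-sym x y with x ≟ y | y ≟ x
    ... | yes _    | yes _   = refl
    ... | no _     | no _    = refl
    ... | yes refl | no y≢x  = contradiction refl y≢x
    ... | no x≢y   | yes refl = contradiction refl x≢y

    adjacent-sym : ∀ x y → adjacent x y ≡ adjacent y x
    adjacent-sym (g , h) (g' , h')
      rewrite adj-sym G-simple g g' | adj-sym H-simple h h' | does-≟-sym g g' | does-≟-sym h h' = refl

    adjacent-irrefl : ∀ x → adjacent x x ≡ false
    adjacent-irrefl (g , h) rewrite adj-irrefl G-simple g | adj-irrefl H-simple h = ∧-zeroʳ _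

module _ {A B K} (P : IsCartesianProduct A B K) where
  open IsCartesianProduct P

  projˡ : ∀ {z w} → Walk K z w → Walk A (fst z) (fst w)
  projˡ [] = []
  projˡ (e ∷ p) with adj⇒ e
  ... | inj₁ (eA , _) = eA ∷ projˡ p
  ... | inj₂ (fst≡ , _) = castWalk fst≡ refl (projˡ p)

  onWalk-projˡ : ∀ {x z w} (p : Walk K z w) → OnWalk x p → OnWalk (fst x) (projˡ p)
  onWalk-projˡ p start = start
  onWalk-projˡ (e ∷ p) (later x∈p) with adj⇒ e
  ... | inj₁ _ = later (onWalk-projˡ p x∈p)
  ... | inj₂ (fst≡ , _) = onWalk-castWalk fst≡ refl (onWalk-projˡ p x∈p)

  liftˡ : ∀ {a a'} b → Walk A a a' → Walk K (pair a b) (pair a' b)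
  liftˡ b [] = []
  liftˡ b (e ∷ p) = adjˡ b e ∷ liftˡ b p

  len-liftˡ : ∀ {a a'} b (p : Walk A a a') → len (liftˡ b p) ≡ len p
  len-liftˡ b [] = refl
  len-liftˡ b (e ∷ p) = cong suc (len-liftˡ b p)

  onWalk-liftˡ : ∀ {x a a'} b (p : Walk A a a') → OnWalk x (liftˡ b p) → ∃ λ g → OnWalk g p × x ≡ pair g b
  onWalk-liftˡ b [] start = _ , start , refl
  onWalk-liftˡ b (e ∷ p) start = _ , start , refl
  onWalk-liftˡ b (e ∷ p) (later x∈) with onWalk-liftˡ b p x∈
  ... | g , g∈p , refl = g , later g∈p , refl

module _ {A B K} (P : IsCartesianProduct A B K) where
  open IsCartesianProduct P

  projʳ : ∀ {z w} → Walk K z w → Walk B (snd z) (snd w)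
  projʳ = projˡ (transpose P)

  liftʳ : ∀ a {b b'} → Walk B b b' → Walk K (pair a b) (pair a b')
  liftʳ a = liftˡ (transpose P) a

  onWalk-projʳ : ∀ {x z w} (p : Walk K z w) → OnWalk x p → OnWalk (snd x) (projʳ p)
  onWalk-projʳ = onWalk-projˡ (transpose P)

  onWalk-liftʳ : ∀ {x} a {b b'} (w : Walk B b b') → OnWalk x (liftʳ a w) → ∃ λ h → x ≡ pair a h
  onWalk-liftʳ a w x∈ with onWalk-liftˡ (transpose P) a w x∈
  ... | h , _ , x≡ = h , x≡

  len-projˡ+len-projʳ : ∀ {z w} (p : Walk K z w) → len (projˡ P p) + len (projʳ p) ≡ len p
  len-projˡ+len-projʳ [] = refl
  len-projˡ+len-projʳ (e ∷ p) with adj⇒ e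
  ... | inj₁ (_ , snd≡) = cong suc (trans (cong (len (projˡ P p) +_) (len-castWalk snd≡ refl (projʳ p))) (len-projˡ+len-projʳ p))
  ... | inj₂ (fst≡ , _) = begin
    len (castWalk fst≡ refl (projˡ P p)) + suc (len (projʳ p))  ≡⟨ cong (_+ _) (len-castWalk fst≡ refl (projˡ P p)) ⟩
    len (projˡ P p) + suc (len (projʳ p))                       ≡⟨ +-suc (len (projˡ P p)) (len (projʳ p)) ⟩
    suc (len (projˡ P p) + len (projʳ p))                       ≡⟨ cong suc (len-projˡ+len-projʳ p) ⟩
    suc (len p)                                                 ∎
    where open ≡-Reasoning

  detour : ∀ {z w} → Walk A (fst z) (fst w) → Walk B (snd z) (snd w) → Walk K z w
  detour {z} {w} q r = castWalk (sym (pair-fst-snd z)) (sym (pair-fst-snd w)) (liftˡ P (snd z) q ++ liftʳ (fst w) r)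

  len-detour : ∀ {z w} (q : Walk A (fst z) (fst w)) (r : Walk B (snd z) (snd w)) → len (detour q r) ≡ len q + len r
  len-detour {z} {w} q r = begin
    len (detour q r)                                    ≡⟨ len-castWalk _ _ _ ⟩
    len (liftˡ P (snd z) q ++ liftʳ (fst w) r)          ≡⟨ len-++ (liftˡ P (snd z) q) _ ⟩
    len (liftˡ P (snd z) q) + len (liftʳ (fst w) r)     ≡⟨ cong₂ _+_ (len-liftˡ P (snd z) q) (len-liftˡ (transpose P) (fst w) r) ⟩
    len q + len r                                       ∎
    where open ≡-Reasoning

  shortest⇒projections-minimal : ∀ {z w} (p : Walk K z w) → IsShortest p →
                                 ∀ q r → len (projˡ P p) + len (projʳ p) ≤ len q + len r
  shortest⇒projections-minimal p p-shortest q r = begin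
    len (projˡ P p) + len (projʳ p)  ≡⟨ len-projˡ+len-projʳ p ⟩
    len p                            ≤⟨ p-shortest (detour q r) ⟩
    len (detour q r)                 ≡⟨ len-detour q r ⟩
    len q + len r                    ∎
    where open ≤-Reasoning

  shortest-projˡ : ∀ {z w} (p : Walk K z w) → IsShortest p → IsShortest (projˡ P p)
  shortest-projˡ p p-shortest q =
    +-cancelʳ-≤ (len (projʳ p)) (len (projˡ P p)) (len q) (shortest⇒projections-minimal p p-shortest q (projʳ p))

  shortest-projʳ : ∀ {z w} (p : Walk K z w) → IsShortest p → IsShortest (projʳ p)
  shortest-projʳ p p-shortest r =
    +-cancelˡ-≤ (len (projˡ P p)) (len (projʳ p)) (len r) (shortest⇒projections-minimal p p-shortest (projˡ P p) r)

module _ {A B K} (P : IsCartesianProduct A B K) where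
  open IsCartesianProduct P

  OnGraph : Subset (order A) → (Vertex A → Vertex B) → Vertex K → Set
  OnGraph S f z = fst z ∈ S × snd z ≡ f (fst z)

  onGraph? : ∀ S f → Decidable (OnGraph S f)
  onGraph? S f z = (fst z ∈? S) ×-dec (snd z ≟ f (fst z))

  -- Opaque, so that S and f can be inferred from the type z ∈ graph S f.
  opaque
    graph : Subset (order A) → (Vertex A → Vertex B) → Subset (order K)
    graph S f = fromDecidable (onGraph? S f)

    ∈-graph⁻ : ∀ {S f z} → z ∈ graph S f → fst z ∈ S × snd z ≡ f (fst z)
    ∈-graph⁻ {S} {f} = ∈-fromDecidable⁻ (onGraph? S f)

    pair∈graph : ∀ {S f a b} → a ∈ S → b ≡ f a → pair a b ∈ graph S f
    pair∈graph {S} {f} {a} {b} a∈S b≡fa = ∈-fromDecidable⁺ (onGraph? S f)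
      (subst (_∈ S) (sym (fst-pair a b)) a∈S , trans (snd-pair a b) (trans b≡fa (cong f (sym (fst-pair a b)))))

  layer : Subset (order A) → Vertex B → Subset (order K)
  layer S b = graph S (const b)

  ∈-graph⁺ : ∀ {S f z} → fst z ∈ S → snd z ≡ f (fst z) → z ∈ graph S f
  ∈-graph⁺ {z = z} fst∈S snd≡ = subst (_∈ graph _ _) (pair-fst-snd z) (pair∈graph fst∈S snd≡)

  graph-cong : ∀ {S f f'} → (∀ {a} → a ∈ S → f a ≡ f' a) → graph S f ≡ graph S f'
  graph-cong {S} {f} {f'} f≗f' = ⊆-antisym (λ z∈ → move z∈ f≗f') (λ z∈ → move z∈ (sym ∘ f≗f'))
    where
    move : ∀ {g g' z} → z ∈ graph S g → (∀ {a} → a ∈ S → g a ≡ g' a) → z ∈ graph S g'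
    move z∈ g≗g' with ∈-graph⁻ z∈
    ... | fst∈S , snd≡ = ∈-graph⁺ fst∈S (trans snd≡ (g≗g' fst∈S))

  graph-split : ∀ {S f a} → a ∈ S → graph S f ≡ graph (S - a) f ∪ ⁅ pair a (f a) ⁆
  graph-split {S} {f} {a} a∈S = ⊆-antisym ⊆split split⊆
    where
    ⊆split : graph S f ⊆ graph (S - a) f ∪ ⁅ pair a (f a) ⁆
    ⊆split {z} z∈ with ∈-graph⁻ z∈ | fst z ≟ a
    ... | _ , snd≡ | yes refl = x∈p∪⁅y⁆⁺ (inj₂ (trans (sym (pair-fst-snd z)) (cong (pair (fst z)) snd≡)))
    ... | fst∈S , snd≡ | no fst≢a = x∈p∪⁅y⁆⁺ (inj₁ (∈-graph⁺ (x∈p∧x≢y⇒x∈p-y fst∈S fst≢a) snd≡))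
    split⊆ : graph (S - a) f ∪ ⁅ pair a (f a) ⁆ ⊆ graph S f
    split⊆ z∈ with x∈p∪⁅y⁆⁻ _ z∈
    ... | inj₁ z∈graph with ∈-graph⁻ z∈graph
    ...   | fst∈S-a , snd≡ = ∈-graph⁺ (x∈p-y⇒x∈p fst∈S-a) snd≡
    split⊆ z∈ | inj₂ refl = pair∈graph a∈S refl

  ∣S∣≤∣layer∣ : ∀ S h → ∣ S ∣ ≤ ∣ layer S h ∣
  ∣S∣≤∣layer∣ S h = ∣p∣≤∣q∣-injection (λ a → pair a h) pair-injective (λ a∈S → pair∈graph a∈S refl)
    where
    pair-injective : Injective _≡_ _≡_ (λ a → pair a h)
    pair-injective {a} {a'} eq = trans (sym (fst-pair a h)) (trans (cong fst eq) (fst-pair a' h))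

  FstInjective : Subset (order K) → Set
  FstInjective C = ∀ {x y} → x ∈ C → y ∈ C → fst x ≡ fst y → x ≡ y

  graph-fstInjective : ∀ {S f} → FstInjective (graph S f)
  graph-fstInjective {f = f} {x} {y} x∈ y∈ fst≡ with ∈-graph⁻ x∈ | ∈-graph⁻ y∈
  ... | _ , snd-x≡ | _ , snd-y≡ = begin
    x                      ≡⟨ sym (pair-fst-snd x) ⟩
    pair (fst x) (snd x)   ≡⟨ cong₂ pair fst≡ (trans snd-x≡ (trans (cong f fst≡) (sym snd-y≡))) ⟩
    pair (fst y) (snd y)   ≡⟨ pair-fst-snd y ⟩
    y                      ∎
    where open ≡-Reasoning

  ∪⁅⁆-fstInjective : ∀ {C v} → FstInjective C → (∀ {z} → z ∈ C → fst z ≢ fst v) → FstInjective (C ∪ ⁅ v ⁆)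
  ∪⁅⁆-fstInjective {C} C-inj fst≢ x∈ y∈ fst≡ with x∈p∪⁅y⁆⁻ C x∈ | x∈p∪⁅y⁆⁻ C y∈
  ... | inj₁ x∈C | inj₁ y∈C = C-inj x∈C y∈C fst≡
  ... | inj₁ x∈C | inj₂ refl = contradiction fst≡ (fst≢ x∈C)
  ... | inj₂ refl | inj₁ y∈C = contradiction (sym fst≡) (fst≢ y∈C)
  ... | inj₂ refl | inj₂ refl = refl

  fstInjective⇒generalPosition : ∀ {S C} → IsGeneralPosition A S → (∀ {z} → z ∈ C → fst z ∈ S) → FstInjective C →
                                 IsGeneralPosition K C
  fstInjective⇒generalPosition S-gp fst∈S C-inj p p-shortest a b c a≢b a≢c b≢c a∈ b∈ c∈ a∈p b∈p c∈p =
    S-gp (projˡ P p) (shortest-projˡ P p p-shortest) (fst a) (fst b) (fst c)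
         (a≢b ∘ C-inj a∈ b∈) (a≢c ∘ C-inj a∈ c∈) (b≢c ∘ C-inj b∈ c∈) (fst∈S a∈) (fst∈S b∈) (fst∈S c∈)
         (onWalk-projˡ P p a∈p) (onWalk-projˡ P p b∈p) (onWalk-projˡ P p c∈p)

  canJoin-graph : ∀ {S Y f a b} → IsGeneralPosition A S → Y ⊆ S → a ∈ S → a ∉ Y → CanJoin K (graph Y f) (pair a b)
  canJoin-graph {S} {Y} {f} {a} {b} S-gp Y⊆S a∈S a∉Y =
    (λ v∈ → a∉Y (subst (_∈ Y) (fst-pair a b) (proj₁ (∈-graph⁻ v∈)))) ,
    fstInjective⇒generalPosition S-gp fst∈S (∪⁅⁆-fstInjective graph-fstInjective fst≢)
    where
    fst∈S : ∀ {z} → z ∈ graph Y f ∪ ⁅ pair a b ⁆ → fst z ∈ S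
    fst∈S z∈ with x∈p∪⁅y⁆⁻ _ z∈
    ... | inj₁ z∈graph = Y⊆S (proj₁ (∈-graph⁻ z∈graph))
    ... | inj₂ refl = subst (_∈ S) (sym (fst-pair a b)) a∈S
    fst≢ : ∀ {z} → z ∈ graph Y f → fst z ≢ fst (pair a b)
    fst≢ z∈ fst≡ = a∉Y (subst (_∈ Y) (trans fst≡ (fst-pair a b)) (proj₁ (∈-graph⁻ z∈)))

  graph-generalPosition : ∀ {S f} → IsGeneralPosition A S → IsGeneralPosition K (graph S f)
  graph-generalPosition S-gp = fstInjective⇒generalPosition S-gp (proj₁ ∘ ∈-graph⁻) graph-fstInjective

  -- A geodesic between two vertices of layer L has constant B-coordinate L, so it misses
  -- pair a k; every other betweenness is ruled out by outerness of X on the A-projection.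
  explorer-generalPosition : IsSimple A → ∀ {X Y a k L} → IsOuterGP A X → Y ⊆ X → a ∉ Y → k ≢ L →
                             IsGeneralPosition K (layer Y L ∪ ⁅ pair a k ⁆)
  explorer-generalPosition A-simple {X} {Y} {a} {k} {L} X-outer Y⊆X a∉Y k≢L = noneBetween⇒generalPosition none
    where
    C = layer Y L ∪ ⁅ pair a k ⁆

    C-inj : FstInjective C
    C-inj = ∪⁅⁆-fstInjective graph-fstInjective
              λ z∈ fst≡ → a∉Y (subst (_∈ Y) (trans fst≡ (fst-pair a k)) (proj₁ (∈-graph⁻ z∈)))

    resident : ∀ {z} → z ∈ C → z ≢ pair a k → fst z ∈ X × snd z ≡ L
    resident z∈ z≢ with x∈p∪⁅y⁆⁻ _ z∈
    ... | inj₁ z∈layer = Prod.map₁ Y⊆X (∈-graph⁻ z∈layer)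
    ... | inj₂ z≡ = contradiction z≡ z≢

    none : NoneBetween C
    none {u} {v} p p-shortest u≢v {m} m∈p m≢u m≢v u∈ m∈ v∈ with u ≟ pair a k | m ≟ pair a k
    ... | yes refl | _ =
      Sum.[ m≢v ∘ C-inj m∈ v∈ , m≢u ∘ C-inj m∈ u∈ ]
        (X-outer _ (proj₁ (resident v∈ (u≢v ∘ sym))) _ (reverse A-simple (projˡ P p))
                 (shortest-reverse A-simple _ (shortest-projˡ P p p-shortest))
                 _ (onWalk-reverse A-simple _ (onWalk-projˡ P p m∈p)) (proj₁ (resident m∈ m≢u)))
    ... | no u≢ | no m≢ =
      Sum.[ m≢u ∘ C-inj m∈ u∈ , m≢v ∘ C-inj m∈ v∈ ]
        (X-outer _ (proj₁ (resident u∈ u≢)) _ (projˡ P p) (shortest-projˡ P p p-shortest)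
                 _ (onWalk-projˡ P p m∈p) (proj₁ (resident m∈ m≢)))
    ... | no u≢ | yes refl = k≢L (begin
      k                       ≡⟨ snd-pair a k ⟨
      snd (pair a k)          ≡⟨ onWalk-shortestLoop (projʳ P p) (shortest-projʳ P p p-shortest) snd-u≡snd-v
                                                     (onWalk-projʳ P p m∈p) ⟩
      snd u                   ≡⟨ proj₂ (resident u∈ u≢) ⟩
      L                       ∎)
      where
      open ≡-Reasoning
      snd-u≡snd-v : snd u ≡ snd v
      snd-u≡snd-v = trans (proj₂ (resident u∈ u≢)) (sym (proj₂ (resident v∈ (m≢v ∘ sym))))

module _ {A B K} (P : IsCartesianProduct A B K) (K-simple : IsSimple K) where
  open IsCartesianProduct P

  moveRobot : ∀ {S f a h} → IsGeneralPosition A S → a ∈ S → Walk B (f a) h →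
              Run K (graph P S f) (graph P S (updateAt f a (const h)))
  moveRobot {S} {f} {a} {h} S-gp a∈S w =
    subst₂ (Run K) (sym (graph-split P a∈S)) arrived
      (walkAlone K-simple (graph P (S - a) f) (liftʳ P a w) canJoin)
    where
    canJoin : ∀ {v} → OnWalk v (liftʳ P a w) → CanJoin K (graph P (S - a) f) v
    canJoin v∈ with onWalk-liftʳ P a w v∈
    ... | _ , refl = canJoin-graph P S-gp x∈p-y⇒x∈p a∈S x∉p-x
    arrived : graph P (S - a) f ∪ ⁅ pair a h ⁆ ≡ graph P S (updateAt f a (const h))
    arrived = begin
      graph P (S - a) f ∪ ⁅ pair a h ⁆
        ≡⟨ cong (_∪ ⁅ pair a h ⁆) (graph-cong P λ {b} b∈S-a → sym (updateAt-minimal b a f (x∈p-y⇒x≢y b∈S-a))) ⟩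
      graph P (S - a) f' ∪ ⁅ pair a h ⁆
        ≡⟨ cong (λ h' → graph P (S - a) f' ∪ ⁅ pair a h' ⁆) (sym (updateAt-updates a f)) ⟩
      graph P (S - a) f' ∪ ⁅ pair a (f' a) ⁆
        ≡⟨ graph-split P a∈S ⟨
      graph P S f' ∎
      where
      open ≡-Reasoning
      f' = updateAt f a (const h)

  reshape : Connected B → ∀ {S} → IsGeneralPosition A S → ∀ f f' → Run K (graph P S f) (graph P S f')
  reshape B-conn {S} S-gp f f' = go (allFin (order A)) f λ _ a∉ → contradiction (∈-allFin _) a∉
    where
    go : ∀ as g → (∀ {a} → a ∈ S → ¬ a ∈ₗ as → g a ≡ f' a) → Run K (graph P S g) (graph P S f')
    go [] g g≗f' = subst (Run K (graph P S g)) (graph-cong P λ a∈S → g≗f' a∈S λ ()) ε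
    go (a ∷ as) g g≗f' with a ∈? S
    ... | yes a∈S = moveRobot S-gp a∈S (B-conn (g a) (f' a)) ◅◅ go as (updateAt g a (const (f' a))) agree
      where
      agree : ∀ {b} → b ∈ S → ¬ b ∈ₗ as → updateAt g a (const (f' a)) b ≡ f' b
      agree {b} b∈S b∉as with b ≟ a
      ... | yes refl = updateAt-updates a g
      ... | no b≢a = trans (updateAt-minimal b a g b≢a) (g≗f' b∈S λ { (here b≡a) → b≢a b≡a ; (there b∈as) → b∉as b∈as })
    ... | no a∉S = go as g λ b∈S b∉as → g≗f' b∈S λ { (here refl) → a∉S b∈S ; (there b∈as) → b∉as b∈as }

  liftMove : ∀ {S T h} → IsGeneralPosition A S → LegalMove A S T → Run K (layer P S h) (layer P T h)
  liftMove {S} {h = h} S-gp (u , v , u∈S , e , v∉S , refl , T-gp) =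
    subst₂ (Run K) (sym (graph-split P u∈S)) arrived
      (walkAlone K-simple (layer P (S - u) h) (adjˡ h e ∷ []) canJoin)
    where
    T = (S - u) ∪ ⁅ v ⁆
    v∉S-u : v ∉ S - u
    v∉S-u = v∉S ∘ x∈p-y⇒x∈p
    v∈T : v ∈ T
    v∈T = x∈p∪⁅y⁆⁺ (inj₂ refl)
    canJoin : ∀ {x} → OnWalk x (adjˡ h e ∷ []) → CanJoin K (layer P (S - u) h) x
    canJoin start = canJoin-graph P S-gp x∈p-y⇒x∈p u∈S x∉p-x
    canJoin (later start) = canJoin-graph P T-gp (x∈p∪⁅y⁆⁺ ∘ inj₁) v∈T v∉S-u
    arrived : layer P (S - u) h ∪ ⁅ pair v h ⁆ ≡ layer P T h
    arrived = begin
      layer P (S - u) h ∪ ⁅ pair v h ⁆  ≡⟨ cong (λ Y → layer P Y h ∪ ⁅ pair v h ⁆) ([p∪⁅x⁆]-x≡p v∉S-u) ⟨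
      layer P (T - v) h ∪ ⁅ pair v h ⁆  ≡⟨ graph-split P v∈T ⟨
      layer P T h                       ∎
      where open ≡-Reasoning

  liftMoves : ∀ {S Ts h} → IsGeneralPosition A S → Moves A S Ts →
              ∀ {g} → Any (g ∈_) (S ∷ Ts) → CanOccupy K (layer P S h) (pair g h)
  liftMoves S-gp moves (here g∈S) = _ , ε , pair∈graph P g∈S refl
  liftMoves S-gp (step m@(_ , _ , _ , _ , _ , _ , T-gp) moves) (there g∈) with liftMoves T-gp moves g∈
  ... | D , r , g∈D = D , liftMove S-gp m ◅◅ r , g∈D

  layer-mobile : Connected B → ∀ {S} → IsMobileGP A S → ∀ h → IsMobileGP K (layer P S h)
  layer-mobile B-conn {S} (S-gp , _ , moves , visitsAll) h = occupyAll⇒mobile K-simple (graph-generalPosition P S-gp) occupy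
    where
    occupy : ∀ z → CanOccupy K (layer P S h) z
    occupy z with liftMoves S-gp moves (visitsAll (fst z))
    ... | D , r , z∈D = D , reshape B-conn S-gp (const h) (const (snd z)) ◅◅ r , subst (_∈ D) (pair-fst-snd z) z∈D

  explorerRun : IsSimple A → Connected A → Connected B → ∀ {X e g k L} → IsOuterGP A X →
                e ∈ X → (g ∈ X → e ≡ g) → k ≢ L → Run K (layer P X L) (layer P (X - e) L ∪ ⁅ pair g k ⁆)
  explorerRun A-simple A-conn B-conn {X} {e} {g} {k} {L} X-outer e∈X g∈X⇒e≡g k≢L with shortestWalk (A-conn e g)
  ... | q , q-shortest =
    subst (λ C → Run K C (layer P (X - e) L ∪ ⁅ pair g k ⁆)) (sym (graph-split P e∈X))
          (walkAlone K-simple (layer P (X - e) L) tour canJoin)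
    where
    tour : Walk K (pair e L) (pair g k)
    tour = liftʳ P e (B-conn L k) ++ liftˡ P k q

    q-avoids-X-e : ∀ {a} → OnWalk a q → a ∉ X - e
    q-avoids-X-e a∈q a∈X-e with X-outer e e∈X g q q-shortest _ a∈q (x∈p-y⇒x∈p a∈X-e)
    ... | inj₁ a≡e = x∈p-y⇒x≢y a∈X-e a≡e
    ... | inj₂ refl = x∈p-y⇒x≢y a∈X-e (sym (g∈X⇒e≡g (x∈p-y⇒x∈p a∈X-e)))

    canJoin : ∀ {v} → OnWalk v tour → CanJoin K (layer P (X - e) L) v
    canJoin v∈ with onWalk-++⁻ (liftʳ P e (B-conn L k)) _ v∈
    ... | inj₁ v∈column with onWalk-liftʳ P e _ v∈column
    ...   | _ , refl = canJoin-graph P (outer⇒generalPosition X-outer) x∈p-y⇒x∈p e∈X x∉p-x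
    canJoin v∈ | inj₂ v∈row with onWalk-liftˡ P k q v∈row
    ...   | a , a∈q , refl =
      (λ v∈layer → q-avoids-X-e a∈q (subst (_∈ X - e) (fst-pair a k) (proj₁ (∈-graph⁻ P v∈layer)))) ,
      explorer-generalPosition P A-simple X-outer x∈p-y⇒x∈p (q-avoids-X-e a∈q) k≢L

  outer-layer-mobile : IsSimple A → Connected A → Connected B → 2 ≤ order B →
                       ∀ {X} → IsOuterGP A X → Nonempty X → ∀ c → IsMobileGP K (layer P X c)
  outer-layer-mobile A-simple A-conn B-conn 2≤|B| {X} X-outer X≠∅ c =
    occupyAll⇒mobile K-simple (graph-generalPosition P X-gp) λ z →
      subst (CanOccupy K (layer P X c)) (pair-fst-snd z) (occupy (fst z) (snd z))
    where
    X-gp : IsGeneralPosition A X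
    X-gp = outer⇒generalPosition X-outer

    occupy : ∀ g k → CanOccupy K (layer P X c) (pair g k)
    occupy g k with ∃-≢ 2≤|B| k | choose-preferring X≠∅ g
    ... | L , k≢L | e , e∈X , g∈X⇒e≡g =
      _ , reshape B-conn X-gp (const c) (const L) ◅◅ explorerRun A-simple A-conn B-conn X-outer e∈X g∈X⇒e≡g k≢L ,
      x∈p∪⁅y⁆⁺ (inj₂ refl)

  mob≤mob : Connected B → Vertex B → ∀ {mA mK} → IsMob A mA → IsMob K mK → mA ≤ mK
  mob≤mob B-conn h ((S , S-mobile , refl) , _) (_ , maximal) =
    ≤-trans (∣S∣≤∣layer∣ P S h) (maximal _ (layer-mobile B-conn S-mobile h))

  gpo≤mob : IsSimple A → Connected A → Connected B → 2 ≤ order B → ∀ {oA mK} → IsGpo A oA → IsMob K mK → oA ≤ mK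
  gpo≤mob A-simple A-conn B-conn 2≤|B| ((X , X-outer , refl) , _) (_ , maximal) with nonempty? X
  ... | yes X≠∅ = ≤-trans (∣S∣≤∣layer∣ P X h) (maximal _ (outer-layer-mobile A-simple A-conn B-conn 2≤|B| X-outer X≠∅ h))
    where h = fromℕ< 2≤|B|
  ... | no X≡∅ = subst (_≤ _) (sym (trans (cong ∣_∣ (Empty-unique X≡∅)) (∣⊥∣≡0 (order A)))) z≤n

proposition2p1 : ∀ (G H : Graph) → IsSimple G → IsSimple H →
                   Connected G → Connected H → 2 ≤ order G → 2 ≤ order H →
                   ∀ (mG mH mGH oG oH : ℕ) →
                   IsMob G mG → IsMob H mH → IsMob (G □ H) mGH →
                   IsGpo G oG → IsGpo H oH →
                   (mG ⊔ mH ≤ mGH) × (oG ⊔ oH ≤ mGH)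
proposition2p1 G H G-simple H-simple G-conn H-conn 2≤|G| 2≤|H| mG mH mGH oG oH mobG mobH mobGH gpoG gpoH =
  ⊔-lub (mob≤mob P K-simple H-conn (fromℕ< 2≤|H|) mobG mobGH) (mob≤mob Pᵀ K-simple G-conn (fromℕ< 2≤|G|) mobH mobGH) ,
  ⊔-lub (gpo≤mob P K-simple G-simple G-conn H-conn 2≤|H| gpoG mobGH)
        (gpo≤mob Pᵀ K-simple H-simple H-conn G-conn 2≤|G| gpoH mobGH)
  where
  P = □-isCartesianProduct G H
  Pᵀ = transpose P
  K-simple = □-isSimple G H G-simple H-simple
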